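{- Let $q$ be a power of an odd prime with $3\mid q-1$, let $\lambda\in\mathbb{F}_q$ be a non-square, and let $a\in\mathbb{F}_q$. Then in the graph $\mathcal{G}(\lambda,X^3+a)$ there are at least $N$ vertices having in-degree zero, where $N=(q-1)/3$ if $-a$ is a cube in $\mathbb{F}_q$, and $N=(q-7)/3$ otherwise. In particular, $\mathcal{G}(\lambda,X^3+a)$ has at least one vertex of in-degree zero.
   Context: For a polynomial $f\in\mathbb{F}_q[X]$ and a non-square $\lambda\in\mathbb{F}_q$, $\mathcal{G}(\lambda,f)$ is the directed graph with vertex set $\mathbb{F}_q$ and an edge from $x$ to $y$ iff $(y^2-f(x))(\lambda y^2-f(x))=0$ (loops allowed). -}

module Defs where

open import Level using (0ℓ)
open import Data.Nat using (ℕ)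
open import Data.Fin using (Fin)
open import Data.Product using (∃; Σ; _,_; _×_)
open import Relation.Nullary using (¬_)
open import Relation.Binary.PropositionalEquality using (_≡_; _≢_)
open import Algebra.Structures using (IsCommutativeRing)
open import Function.Bundles using (_↔_)

record FiniteField (q : ℕ) : Set₁ where
  infixl 7 _*_
  infixl 6 _+_ _-_
  field
    Carrier : Set
    _+_ _*_ : Carrier → Carrier → Carrier
    -_      : Carrier → Carrier
    0# 1#   : Carrier
    isCommutativeRing : IsCommutativeRing _≡_ _+_ _*_ -_ 0# 1#
    0≢1     : 0# ≢ 1#
    inverse : ∀ x → x ≢ 0# → ∃ λ y → x * y ≡ 1#
    enum    : Fin q ↔ Carrier

  _-_ : Carrier → Carrier → Carrier
  x - y = x + (- y)

  IsSquare : Carrier → Set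
  IsSquare x = ∃ λ z → z * z ≡ x

  IsCube : Carrier → Set
  IsCube x = ∃ λ z → z * z * z ≡ x

  Edge : Carrier → (Carrier → Carrier) → Carrier → Carrier → Set
  Edge l f x y = (y * y - f x) * (l * (y * y) - f x) ≡ 0#

  InDegreeZero : Carrier → (Carrier → Carrier) → Carrier → Set
  InDegreeZero l f y = ∀ x → ¬ Edge l f x y

  AtLeast : ℕ → (Carrier → Set) → Set
  AtLeast N P = Σ (Fin N → Carrier) λ v →
                  (∀ i j → v i ≡ v j → i ≡ j) × (∀ i → P (v i))

-- A primitive cube root of unity ω exists because 3 ∣ q − 1, so the nonzero elements split into
-- t = (q − 1)/3 orbits {x, ωx, ω²x}, on each of which f(x) = x³ + a is constant.  An edge x → y
-- means f(x) ∈ {y², λy²}; as λ is not a square, a vertex y ≠ 0 with an in-edge is determined up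
-- to sign by the value f(x) ≠ 0.  So at most 1 + 2c vertices have positive in-degree, where c
-- counts the t + 1 orbit classes (including {0}) on which f ≠ 0, and c ≤ t when −a is a cube,
-- since one class is then a root of f.  This leaves at least q − 1 − 2t = t, respectively
-- q − 3 − 2t = t − 2, vertices of in-degree zero; if −a is not a cube, 0 is one of them.

module Submission where

open import Defs
open import Data.Nat using (ℕ; suc; _∸_; _^_; _/_; _%_)
open import Data.Nat.Divisibility using (_∣_)
open import Data.Nat.Primality using (Prime)
open import Data.Product using (∃; ∃₂; _×_)
open import Relation.Nullary using (¬_)
open import Relation.Binary.PropositionalEquality using (_≡_)

open import Level using (0ℓ)
open import Algebra.Bundles using (CommutativeRing)
open import Algebra.Structures using (IsCommutativeRing)
open import Data.Empty using (⊥-elim)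
open import Data.Fin using (Fin; zero; suc; combine; remQuot; inject≤; _<?_)
import Data.Fin.Properties as Fin
import Data.Nat as ℕ
open import Data.Nat using (zero)
import Data.Nat.Properties as ℕ
open import Data.Nat.Divisibility using (∣1⇒≡1; ∣m+n∣m⇒∣n; m∣m*n)
open import Data.Nat.DivMod using (m*n/n≡m)
open import Data.Product using (Σ; _,_; proj₁; proj₂; uncurry)
open import Data.Sum as Sum using (_⊎_; inj₁; inj₂; [_,_])
open import Function using (_∘_; _↔_; Inverse)
open import Relation.Binary.Definitions using (DecidableEquality; tri<; tri≈; tri>)
open import Relation.Binary.PropositionalEquality
  using (_≢_; refl; sym; trans; cong; cong₂; subst; module ≡-Reasoning)
open import Relation.Nullary using (Dec; yes; no; contradiction)
open import Relation.Nullary.Decidable using (map′; ¬?; _×-dec_; _⊎-dec_)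
open import Relation.Unary using (Pred; Decidable)
open import Relation.Unary.Properties using (∁?; U?)

module Counting where

  open import Data.Nat using (_+_; _*_; _≤_; _<_)

  record Listing {A : Set} (P : Pred A 0ℓ) (k : ℕ) : Set where
    field
      elem           : Fin k → A
      elem-injective : ∀ {i j} → elem i ≡ elem j → i ≡ j
      elem-sat       : ∀ i → P (elem i)
      index          : ∀ {x} → P x → Fin k
      elem-index     : ∀ {x} (p : P x) → elem (index p) ≡ x

  open Listing public

  index-injective : ∀ {A : Set} {P : Pred A 0ℓ} {k} (L : Listing P k) {x y} (p : P x) (p′ : P y) →
                    index L p ≡ index L p′ → x ≡ y
  index-injective L p p′ e = trans (sym (elem-index L p)) (trans (cong (elem L) e) (elem-index L p′))

  module FinCounting where

    count : ∀ {n} {P : Pred (Fin n) 0ℓ} → Decidable P → ℕ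
    count {zero}  P? = 0
    count {suc n} P? with P? zero
    ... | yes _ = suc (count (P? ∘ suc))
    ... | no  _ = count (P? ∘ suc)

    private
      cons : ∀ {n k} {P : Pred (Fin (suc n)) 0ℓ} →
             P zero → Listing (P ∘ suc) k → Listing P (suc k)
      cons p L .elem zero    = zero
      cons p L .elem (suc i) = suc (L .elem i)
      cons p L .elem-injective {zero}  {zero}  _ = refl
      cons p L .elem-injective {suc i} {suc j} e =
        cong suc (L .elem-injective (Fin.suc-injective e))
      cons p L .elem-sat zero    = p
      cons p L .elem-sat (suc i) = L .elem-sat i
      cons p L .index {zero}  _ = zero
      cons p L .index {suc x} q = suc (L .index q)
      cons p L .elem-index {zero}  _ = refl
      cons p L .elem-index {suc x} q = cong suc (L .elem-index q)

      skip : ∀ {n k} {P : Pred (Fin (suc n)) 0ℓ} →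
             ¬ P zero → Listing (P ∘ suc) k → Listing P k
      skip ¬p L .elem i = suc (L .elem i)
      skip ¬p L .elem-injective e = L .elem-injective (Fin.suc-injective e)
      skip ¬p L .elem-sat = L .elem-sat
      skip ¬p L .index {zero}  p = contradiction p ¬p
      skip ¬p L .index {suc x} q = L .index q
      skip ¬p L .elem-index {zero}  p = contradiction p ¬p
      skip ¬p L .elem-index {suc x} q = cong suc (L .elem-index q)

    listing : ∀ {n} {P : Pred (Fin n) 0ℓ} (P? : Decidable P) → Listing P (count P?)
    listing {zero} P? .elem ()
    listing {zero} P? .elem-injective {()}
    listing {zero} P? .elem-sat ()
    listing {zero} P? .index {()}
    listing {zero} P? .elem-index {()}
    listing {suc n} P? with P? zero
    ... | yes p = cons p (listing (P? ∘ suc))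
    ... | no ¬p = skip ¬p (listing (P? ∘ suc))

    count-complement : ∀ {n} {P : Pred (Fin n) 0ℓ} (P? : Decidable P) →
                       count P? + count (∁? P?) ≡ n
    count-complement {zero}  P? = refl
    count-complement {suc n} P? with P? zero
    ... | yes _ = cong suc (count-complement (P? ∘ suc))
    ... | no  _ = trans (ℕ.+-suc _ _) (cong suc (count-complement (P? ∘ suc)))

  module Enumerated {A : Set} {n : ℕ} (enum : Fin n ↔ A) where

    open Inverse enum using (to; from; strictlyInverseˡ; strictlyInverseʳ)

    to-injective : ∀ {i j} → to i ≡ to j → i ≡ j
    to-injective {i} {j} e =
      trans (sym (strictlyInverseʳ i)) (trans (cong from e) (strictlyInverseʳ j))

    from-injective : ∀ {x y} → from x ≡ from y → x ≡ y
    from-injective {x} {y} e =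
      trans (sym (strictlyInverseˡ x)) (trans (cong to e) (strictlyInverseˡ y))

    infix 4 _≟_
    _≟_ : DecidableEquality A
    x ≟ y = map′ from-injective (cong from) (from x Fin.≟ from y)

    any? : {P : Pred A 0ℓ} → Decidable P → Dec (∃ P)
    any? {P} P? = map′ (λ (i , p) → to i , p)
                       (λ (x , p) → from x , subst P (sym (strictlyInverseˡ x)) p)
                       (Fin.any? (P? ∘ to))

    all? : {P : Pred A 0ℓ} → Decidable P → Dec (∀ x → P x)
    all? {P} P? = map′ (λ all x → subst P (strictlyInverseˡ x) (all (from x)))
                       (λ all i → all (to i))
                       (Fin.all? (P? ∘ to))

    count : {P : Pred A 0ℓ} → Decidable P → ℕ
    count P? = FinCounting.count (P? ∘ to)

    listing : {P : Pred A 0ℓ} (P? : Decidable P) → Listing P (count P?)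
    listing {P} P? = record
      { elem           = to ∘ L.elem
      ; elem-injective = L.elem-injective ∘ to-injective
      ; elem-sat       = L.elem-sat
      ; index          = λ {x} p → L.index (subst P (sym (strictlyInverseˡ x)) p)
      ; elem-index     = λ {x} p → trans (cong to (L.elem-index _)) (strictlyInverseˡ x)
      }
      where module L = Listing (FinCounting.listing (P? ∘ to))

    count-complement : {P : Pred A 0ℓ} (P? : Decidable P) → count P? + count (∁? P?) ≡ n
    count-complement P? = FinCounting.count-complement (P? ∘ to)

    injective⇒count≤ : {P : Pred A 0ℓ} (P? : Decidable P) {m : ℕ} (h : ∀ x → P x → Fin m) →
                       (∀ {x y} (p : P x) (p′ : P y) → h x p ≡ h y p′ → x ≡ y) →
                       count P? ≤ m
    injective⇒count≤ P? h h-injective =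
      Fin.injective⇒≤ (elem-injective L ∘ h-injective (elem-sat L _) (elem-sat L _))
      where L = listing P?

    injective⇒≤count : {P : Pred A 0ℓ} (P? : Decidable P) {m : ℕ} (v : Fin m → A) →
                       (∀ {i j} → v i ≡ v j → i ≡ j) → (∀ i → P (v i)) →
                       m ≤ count P?
    injective⇒≤count P? v v-injective v-sat =
      Fin.injective⇒≤ λ e → v-injective (index-injective L (v-sat _) (v-sat _) e)
      where L = listing P?

    bijection⇒count≡ : {P : Pred A 0ℓ} (P? : Decidable P) {m : ℕ} (v : Fin m → A) →
                       (∀ {i j} → v i ≡ v j → i ≡ j) → (∀ i → P (v i)) →
                       (∀ {x} → P x → ∃ λ i → v i ≡ x) →
                       count P? ≡ m
    bijection⇒count≡ P? v v-injective v-sat v-onto = ℕ.≤-antisym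
      (injective⇒count≤ P? (λ _ → proj₁ ∘ v-onto)
        λ p p′ e → trans (sym (proj₂ (v-onto p))) (trans (cong v e) (proj₂ (v-onto p′))))
      (injective⇒≤count P? v v-injective v-sat)

    count-U : count U? ≡ n
    count-U = bijection⇒count≡ U? to to-injective _ (λ {x} _ → from x , strictlyInverseˡ x)

    ⊆⇒count≤ : {P Q : Pred A 0ℓ} (P? : Decidable P) (Q? : Decidable Q) →
               (∀ {x} → P x → Q x) → count P? ≤ count Q?
    ⊆⇒count≤ P? Q? P⊆Q = injective⇒≤count Q? (elem L) (elem-injective L) (P⊆Q ∘ elem-sat L)
      where L = listing P?

    ⊆⇒count< : {P Q : Pred A 0ℓ} (P? : Decidable P) (Q? : Decidable Q) →
               (∀ {x} → P x → Q x) → ∀ {d} → Q d → ¬ P d → count P? < count Q?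
    ⊆⇒count< {P} {Q} P? Q? P⊆Q {d} Qd ¬Pd = injective⇒≤count Q? v v-injective v-sat
      where
      L = listing P?

      v : Fin (suc (count P?)) → A
      v zero    = d
      v (suc i) = elem L i

      v-injective : ∀ {i j} → v i ≡ v j → i ≡ j
      v-injective {zero}  {zero}  _ = refl
      v-injective {zero}  {suc j} e = contradiction (subst P (sym e) (elem-sat L j)) ¬Pd
      v-injective {suc i} {zero}  e = contradiction (subst P e (elem-sat L i)) ¬Pd
      v-injective {suc i} {suc j} e = cong suc (elem-injective L e)

      v-sat : ∀ i → Q (v i)
      v-sat zero    = Qd
      v-sat (suc i) = P⊆Q (elem-sat L i)

    ≤count⇒distinct : {P : Pred A 0ℓ} (P? : Decidable P) {m : ℕ} → m ≤ count P? →
                      Σ (Fin m → A) λ v → (∀ i j → v i ≡ v j → i ≡ j) × (∀ i → P (v i))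
    ≤count⇒distinct P? m≤c =
      (λ i → elem L (inject≤ i m≤c)) ,
      (λ i j e → Fin.inject≤-injective m≤c m≤c i j (elem-injective L e)) ,
      (λ i → elem-sat L (inject≤ i m≤c))
      where L = listing P?

    orderBit : A → A → Fin 2
    orderBit x y with from x <? from y
    ... | yes _ = zero
    ... | no  _ = suc zero

    orderBit-comm⇒≡ : ∀ x y → orderBit x y ≡ orderBit y x → x ≡ y
    orderBit-comm⇒≡ x y e with from x <? from y | from y <? from x
    ... | yes x<y | yes y<x = contradiction y<x (Fin.<-asym x<y)
    ... | no  x≮y | no  y≮x with Fin.<-cmp (from x) (from y)
    ...   | tri< x<y _ _ = contradiction x<y x≮y
    ...   | tri≈ _ x≡y _ = from-injective x≡y
    ...   | tri> _ _ y<x = contradiction y<x y≮x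

  module Order3Orbits {A : Set} {n : ℕ} (enum : Fin n ↔ A) (σ : A → A)
    {P : Pred A 0ℓ} (P? : Decidable P)
    (σ-preserves : ∀ {x} → P x → P (σ x))
    (σ³≡id : ∀ {x} → P x → σ (σ (σ x)) ≡ x)
    (σ-fixedPointFree : ∀ {x} → P x → σ x ≢ x)
    where

    open Inverse enum using (to; from; strictlyInverseˡ; strictlyInverseʳ)
    open Enumerated enum
    open import Algebra.Construct.NaturalChoice.Min (Fin.≤-totalOrder n)
      using (_⊓_; ⊓-comm; ⊓-assoc; ⊓-sel)

    σ^ : Fin 3 → A → A
    σ^ zero             x = x
    σ^ (suc zero)       x = σ x
    σ^ (suc (suc zero)) x = σ (σ x)

    σ^-preserves : ∀ i {x} → P x → P (σ^ i x)
    σ^-preserves zero             p = p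
    σ^-preserves (suc zero)       p = σ-preserves p
    σ^-preserves (suc (suc zero)) p = σ-preserves (σ-preserves p)

    σ^-injectiveˡ : ∀ {x} → P x → ∀ {i j} → σ^ i x ≡ σ^ j x → i ≡ j
    σ^-injectiveˡ {x} p = go _ _
      where
      σ²-free : σ (σ x) ≢ x
      σ²-free e = σ-fixedPointFree p (trans (cong σ (sym e)) (σ³≡id p))

      go : ∀ i j → σ^ i x ≡ σ^ j x → i ≡ j
      go zero             zero             _ = refl
      go zero             (suc zero)       e = contradiction (sym e) (σ-fixedPointFree p)
      go zero             (suc (suc zero)) e = contradiction (sym e) σ²-free
      go (suc zero)       zero             e = contradiction e (σ-fixedPointFree p)
      go (suc zero)       (suc zero)       _ = refl
      go (suc zero)       (suc (suc zero)) e = contradiction (sym e) (σ-fixedPointFree (σ-preserves p))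
      go (suc (suc zero)) zero             e = contradiction e σ²-free
      go (suc (suc zero)) (suc zero)       e = contradiction e (σ-fixedPointFree (σ-preserves p))
      go (suc (suc zero)) (suc (suc zero)) _ = refl

    -- Orbits are labelled by the least index of their three elements.
    label : A → Fin n
    label x = from x ⊓ from (σ x) ⊓ from (σ (σ x))

    label-σ : ∀ {x} → P x → label (σ x) ≡ label x
    label-σ {x} p = begin
      from (σ x) ⊓ from (σ (σ x)) ⊓ from (σ (σ (σ x))) ≡⟨ cong ((from (σ x) ⊓ from (σ (σ x)) ⊓_) ∘ from) (σ³≡id p) ⟩
      from (σ x) ⊓ from (σ (σ x)) ⊓ from x              ≡⟨ ⊓-comm _ (from x) ⟩
      from x ⊓ (from (σ x) ⊓ from (σ (σ x)))            ≡⟨ sym (⊓-assoc (from x) _ _) ⟩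
      label x                                           ∎
      where open ≡-Reasoning

    label∈orbit : ∀ x → ∃ λ i → label x ≡ from (σ^ i x)
    label∈orbit x with ⊓-sel (from x ⊓ from (σ x)) (from (σ (σ x))) | ⊓-sel (from x) (from (σ x))
    ... | inj₂ e | _      = suc (suc zero) , e
    ... | inj₁ e | inj₁ f = zero , trans e f
    ... | inj₁ e | inj₂ f = suc zero , trans e f

    label-σ^ : ∀ i {x} → P x → label (σ^ i x) ≡ label x
    label-σ^ zero             p = refl
    label-σ^ (suc zero)       p = label-σ p
    label-σ^ (suc (suc zero)) p = trans (label-σ (σ-preserves p)) (label-σ p)

    IsRep : Pred A 0ℓ
    IsRep x = P x × label x ≡ from x

    IsRep? : Decidable IsRep
    IsRep? x with P? x | label x Fin.≟ from x
    ... | yes p | yes e = yes (p , e)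
    ... | no ¬p | _     = no (¬p ∘ proj₁)
    ... | _     | no ¬e = no (¬e ∘ proj₂)

    repOf : A → A
    repOf x = to (label x)

    repOf∈orbit : ∀ x → ∃ λ i → repOf x ≡ σ^ i x
    repOf∈orbit x with label∈orbit x
    ... | i , e = i , trans (cong to e) (strictlyInverseˡ (σ^ i x))

    repOf-isRep : ∀ {x} → P x → IsRep (repOf x)
    repOf-isRep {x} p = subst P (sym e) (σ^-preserves i p) , (begin
      label (repOf x)   ≡⟨ cong label e ⟩
      label (σ^ i x)    ≡⟨ label-σ^ i p ⟩
      label x           ≡⟨ sym (strictlyInverseʳ (label x)) ⟩
      from (repOf x)    ∎)
      where
      open ≡-Reasoning
      i = proj₁ (repOf∈orbit x)
      e = proj₂ (repOf∈orbit x)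

    σ^-undo : ∀ i {x} → P x → ∃ λ j → σ^ j (σ^ i x) ≡ x
    σ^-undo zero             p = zero , refl
    σ^-undo (suc zero)       p = suc (suc zero) , σ³≡id p
    σ^-undo (suc (suc zero)) p = suc zero , σ³≡id p

    orbit-of-repOf : ∀ {x} → P x → ∃ λ j → σ^ j (repOf x) ≡ x
    orbit-of-repOf {x} p = j , trans (cong (σ^ j) e) undo
      where
      i = proj₁ (repOf∈orbit x)
      e = proj₂ (repOf∈orbit x)
      j = proj₁ (σ^-undo i p)
      undo = proj₂ (σ^-undo i p)

    isRep-unique : ∀ {r s} → IsRep r → IsRep s → ∀ i j → σ^ i r ≡ σ^ j s → r ≡ s
    isRep-unique {r} {s} (pr , er) (ps , es) i j e = from-injective (begin
      from r          ≡⟨ sym er ⟩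
      label r         ≡⟨ sym (label-σ^ i pr) ⟩
      label (σ^ i r)  ≡⟨ cong label e ⟩
      label (σ^ j s)  ≡⟨ label-σ^ j ps ⟩
      label s         ≡⟨ es ⟩
      from s          ∎)
      where open ≡-Reasoning

    orbit-count : count P? ≡ 3 * count IsRep?
    orbit-count = bijection⇒count≡ P? v v-injective v-sat v-onto
      where
      c = count IsRep?
      R = listing IsRep?

      point : Fin 3 × Fin c → A
      point (i , j) = σ^ i (elem R j)

      point-injective : ∀ {a b} → point a ≡ point b → a ≡ b
      point-injective {i , j} {i′ , j′} e = cong₂ _,_ i≡i′ j≡j′
        where
        j≡j′ = elem-injective R (isRep-unique (elem-sat R j) (elem-sat R j′) i i′ e)
        i≡i′ = σ^-injectiveˡ (proj₁ (elem-sat R j)) (trans e (cong (λ k → σ^ i′ (elem R k)) (sym j≡j′)))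

      v : Fin (3 * c) → A
      v k = point (remQuot {3} c k)

      v-sat : ∀ k → P (v k)
      v-sat k = σ^-preserves (proj₁ (remQuot {3} c k)) (proj₁ (elem-sat R _))

      v-injective : ∀ {k l} → v k ≡ v l → k ≡ l
      v-injective {k} {l} e = begin
        k                                         ≡⟨ sym (Fin.combine-remQuot {3} c k) ⟩
        uncurry combine (remQuot {3} c k)         ≡⟨ cong (uncurry combine) (point-injective {remQuot c k} {remQuot c l} e) ⟩
        uncurry combine (remQuot {3} c l)         ≡⟨ Fin.combine-remQuot {3} c l ⟩
        l                                         ∎
        where open ≡-Reasoning

      v-onto : ∀ {x} → P x → ∃ λ k → v k ≡ x
      v-onto {x} p = combine i j , (begin
        v (combine i j)    ≡⟨ cong point (Fin.remQuot-combine i j) ⟩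
        σ^ i (elem R j)    ≡⟨ cong (σ^ i) (elem-index R (repOf-isRep p)) ⟩
        σ^ i (repOf x)     ≡⟨ proj₂ (orbit-of-repOf p) ⟩
        x                  ∎)
        where
        open ≡-Reasoning
        i = proj₁ (orbit-of-repOf p)
        j = index R (repOf-isRep p)

open Counting

module Arithmetic where

  open import Data.Nat using (_+_; _*_; _≤_)
  open import Data.Nat.Solver using (module +-*-Solver)
  open +-*-Solver using (solve; _:=_; _:+_; _:*_; con)

  3∣n⇒3∤1+n : ∀ {m} → 3 ∣ m → ¬ 3 ∣ suc m
  3∣n⇒3∤1+n {m} 3∣m 3∣1+m
    with () ← ∣1⇒≡1 (∣m+n∣m⇒∣n (subst (3 ∣_) (ℕ.+-comm 1 m) 3∣1+m) 3∣m)

  ∸-lower-bound : ∀ {g b r t} e → g + b ≡ suc (t * 3) → b ≤ suc (r * 2) → r ≤ e + t → t ∸ e * 2 ≤ g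
  ∸-lower-bound {g} {b} {r} {t} e g+b≡ b≤ r≤ =
    ℕ.m≤n+o⇒m∸n≤o t (e * 2) (ℕ.+-cancelʳ-≤ (suc (t * 2)) t (e * 2 + g) (begin
      t + suc (t * 2)         ≡⟨ solve 1 (λ t → t :+ (con 1 :+ t :* con 2) := con 1 :+ t :* con 3) refl t ⟩
      suc (t * 3)             ≡⟨ sym g+b≡ ⟩
      g + b                   ≤⟨ ℕ.+-monoʳ-≤ g (ℕ.≤-trans b≤ (ℕ.s≤s (ℕ.*-monoˡ-≤ 2 r≤))) ⟩
      g + suc ((e + t) * 2)   ≡⟨ solve 3 (λ g e t → g :+ (con 1 :+ (e :+ t) :* con 2)
                                                    := e :* con 2 :+ g :+ (con 1 :+ t :* con 2)) refl g e t ⟩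
      e * 2 + g + suc (t * 2) ∎))
    where open ℕ.≤-Reasoning

open Arithmetic

module FieldProperties {q : ℕ} (F : FiniteField q) where

  open FiniteField F
  open IsCommutativeRing isCommutativeRing
    using (+-comm; +-identityˡ; +-identityʳ; -‿inverseˡ; -‿inverseʳ;
           *-assoc; *-comm; *-identityˡ; *-identityʳ; zeroˡ; zeroʳ)

  commutativeRing : CommutativeRing 0ℓ 0ℓ
  commutativeRing = record { isCommutativeRing = isCommutativeRing }

  open import Algebra.Properties.Ring (CommutativeRing.ring commutativeRing)
    using (-‿involutive; +-inverseʳ-unique; +-cancelˡ; +-cancelʳ; x∙y⁻¹≈ε⇒x≈y; -‿distribˡ-*)
  open import Algebra.Solver.Ring.NaturalCoefficients.Default
    (CommutativeRing.commutativeSemiring commutativeRing) using (solve; _:=_; _:+_; _:*_; con)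
  open Inverse enum using (to; from; strictlyInverseˡ)
  open Enumerated enum public using (_≟_; any?)
  open Enumerated enum
    using (all?; count; count-U; listing; count-complement; injective⇒count≤; injective⇒≤count;
           bijection⇒count≡; ⊆⇒count≤; ⊆⇒count<)

  -- Consequences of relations x = 0, y = 0 are read off identities e₁ + u x = v y + e₂,
  -- which involve no subtraction and so are semiring identities.
  cancel-vanishing : ∀ {e₁ e₂ x y} u v → e₁ + u * x ≡ v * y + e₂ → x ≡ 0# → y ≡ 0# → e₁ ≡ e₂
  cancel-vanishing {e₁} {e₂} u v e refl refl = begin
    e₁              ≡⟨ sym (+-identityʳ e₁) ⟩
    e₁ + 0#         ≡⟨ cong (e₁ +_) (sym (zeroʳ u)) ⟩
    e₁ + u * 0#     ≡⟨ e ⟩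
    v * 0# + e₂     ≡⟨ cong (_+ e₂) (zeroʳ v) ⟩
    0# + e₂         ≡⟨ +-identityˡ e₂ ⟩
    e₂              ∎
    where open ≡-Reasoning

  infix 8 _⁻¹
  _⁻¹ : Carrier → Carrier
  x ⁻¹ with x ≟ 0#
  ... | yes _   = 0#
  ... | no  x≢0 = proj₁ (inverse x x≢0)

  x*x⁻¹≡1 : ∀ {x} → x ≢ 0# → x * x ⁻¹ ≡ 1#
  x*x⁻¹≡1 {x} x≢0 with x ≟ 0#
  ... | yes x≡0 = contradiction x≡0 x≢0
  ... | no  x≢0 = proj₂ (inverse x x≢0)

  *-cancelˡ : ∀ {c x y} → c ≢ 0# → c * x ≡ c * y → x ≡ y
  *-cancelˡ {c} {x} {y} c≢0 e = trans (sym (recover x)) (trans (cong (c ⁻¹ *_) e) (recover y))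
    where
    recover : ∀ z → c ⁻¹ * (c * z) ≡ z
    recover z = begin
      c ⁻¹ * (c * z)   ≡⟨ sym (*-assoc _ c z) ⟩
      c ⁻¹ * c * z     ≡⟨ cong (_* z) (trans (*-comm _ c) (x*x⁻¹≡1 c≢0)) ⟩
      1# * z           ≡⟨ *-identityˡ z ⟩
      z                ∎
      where open ≡-Reasoning

  zero-product : ∀ {x y} → x * y ≡ 0# → x ≡ 0# ⊎ y ≡ 0#
  zero-product {x} {y} xy≡0 with x ≟ 0#
  ... | yes x≡0 = inj₁ x≡0
  ... | no  x≢0 = inj₂ (*-cancelˡ x≢0 (trans xy≡0 (sym (zeroʳ x))))

  *-nonZero : ∀ {x y} → x ≢ 0# → y ≢ 0# → x * y ≢ 0#
  *-nonZero x≢0 y≢0 xy≡0 = [ x≢0 , y≢0 ] (zero-product xy≡0)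

  square-≡⇒± : ∀ {y z} → y * y ≡ z * z → z ≡ y ⊎ z ≡ - y
  square-≡⇒± {y} {z} y²≡z² =
    Sum.map (sym ∘ x∙y⁻¹≈ε⇒x≈y y z) (+-inverseʳ-unique y z) (zero-product [y-z][y+z]≡0)
    where
    [y-z][y+z]≡0 : (y - z) * (y + z) ≡ 0#
    [y-z][y+z]≡0 = +-cancelʳ (z * z) _ _ (begin
      (y - z) * (y + z) + z * z  ≡⟨ solve 3 (λ y z w → (y :+ w) :* (y :+ z) :+ z :* z
                                                   := (y :+ z) :* (z :+ w) :+ y :* y) refl y z (- z) ⟩
      (y + z) * (z - z) + y * y  ≡⟨ cong₂ (λ d e → (y + z) * d + e) (-‿inverseʳ z) y²≡z² ⟩
      (y + z) * 0# + z * z       ≡⟨ cong (_+ z * z) (zeroʳ (y + z)) ⟩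
      0# + z * z                 ∎)
      where open ≡-Reasoning

  -- If 3 = 0, translation by 1 has order 3 and no fixed points, so 3 ∣ q.
  1+1+1≢0 : 3 ∣ q ∸ 1 → 1# + 1# + 1# ≢ 0#
  1+1+1≢0 3∣q-1 3≡0 = 3∣n⇒3∤1+n 3∣q-1 (subst (3 ∣_) q≡1+[q∸1] 3∣q)
    where
    inhabited⇒≡suc : ∀ {m} → Fin m → m ≡ suc (m ∸ 1)
    inhabited⇒≡suc {suc _} _ = refl

    q≡1+[q∸1] : q ≡ suc (q ∸ 1)
    q≡1+[q∸1] = inhabited⇒≡suc (from 0#)

    translate-thrice : ∀ x → x + 1# + 1# + 1# ≡ x
    translate-thrice x = begin
      x + 1# + 1# + 1#      ≡⟨ solve 1 (λ x → x :+ con 1 :+ con 1 :+ con 1 := x :+ (con 1 :+ con 1 :+ con 1)) refl x ⟩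
      x + (1# + 1# + 1#)    ≡⟨ cong (x +_) 3≡0 ⟩
      x + 0#                ≡⟨ +-identityʳ x ⟩
      x                     ∎
      where open ≡-Reasoning

    translate-free : ∀ x → x + 1# ≢ x
    translate-free x e = 0≢1 (sym (+-cancelˡ x 1# 0# (trans e (sym (+-identityʳ x)))))

    open Order3Orbits enum (_+ 1#) U? _ (λ {x} _ → translate-thrice x) (λ {x} _ → translate-free x)

    3∣q : 3 ∣ q
    3∣q = subst (3 ∣_) (trans (sym orbit-count) count-U) (m∣m*n (count IsRep?))

  -- The Möbius map y ↦ −1/(1+y) has order 3 and cycles 0 ↦ −1 ↦ ∞ ↦ 0 on the projective line,
  -- so it permutes the q − 2 points outside {0, −1}; as 3 ∤ q − 2, it fixes some y there,
  -- and then y² + y + 1 = 0.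
  NotZeroOrMinusOne : Pred Carrier 0ℓ
  NotZeroOrMinusOne y = y ≢ 0# × y ≢ - 1#

  NotZeroOrMinusOne? : Decidable NotZeroOrMinusOne
  NotZeroOrMinusOne? y = ¬? (y ≟ 0#) ×-dec ¬? (y ≟ - 1#)

  mobius : Carrier → Carrier
  mobius y = - ((1# + y) ⁻¹)

  1+y≢0 : ∀ {y} → y ≢ - 1# → 1# + y ≢ 0#
  1+y≢0 y≢-1 1+y≡0 = y≢-1 (+-inverseʳ-unique 1# _ 1+y≡0)

  mobius-equation : ∀ {y} → y ≢ - 1# → mobius y * (1# + y) + 1# ≡ 0#
  mobius-equation {y} y≢-1 = begin
    - ((1# + y) ⁻¹) * (1# + y) + 1#   ≡⟨ cong (_+ 1#) (sym (-‿distribˡ-* _ _)) ⟩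
    - ((1# + y) ⁻¹ * (1# + y)) + 1#   ≡⟨ cong (λ z → - z + 1#) (trans (*-comm _ _) (x*x⁻¹≡1 (1+y≢0 y≢-1))) ⟩
    - 1# + 1#                         ≡⟨ -‿inverseˡ 1# ⟩
    0#                                ∎
    where open ≡-Reasoning

  mobius-preserves : ∀ {y} → NotZeroOrMinusOne y → NotZeroOrMinusOne (mobius y)
  mobius-preserves {y} (y≢0 , y≢-1) = z≢0 , z≢-1
    where
    z = mobius y

    z≢0 : z ≢ 0#
    z≢0 z≡0 = 0≢1 (sym (begin
      1#                 ≡⟨ sym (+-identityˡ 1#) ⟩
      0# + 1#            ≡⟨ cong (_+ 1#) (sym (zeroˡ (1# + y))) ⟩
      0# * (1# + y) + 1# ≡⟨ cong (λ w → w * (1# + y) + 1#) (sym z≡0) ⟩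
      z * (1# + y) + 1#  ≡⟨ mobius-equation y≢-1 ⟩
      0#                 ∎))
      where open ≡-Reasoning

    z≢-1 : z ≢ - 1#
    z≢-1 z≡-1 = [ z≢0 , y≢0 ] (zero-product zy≡0)
      where
      zy≡0 : z * y ≡ 0#
      zy≡0 = cancel-vanishing 1# 1#
        (solve 2 (λ z y → z :* y :+ con 1 :* (con 1 :+ z) := con 1 :* (z :* (con 1 :+ y) :+ con 1) :+ con 0) refl z y)
        (trans (cong (1# +_) z≡-1) (-‿inverseʳ 1#)) (mobius-equation y≢-1)

  mobius³≡id : ∀ {a} → NotZeroOrMinusOne a → mobius (mobius (mobius a)) ≡ a
  mobius³≡id {a} p@(_ , a≢-1) = sym (cancel-vanishing d a
    (solve 3 (λ a c d → a :+ d :* (c :* a :+ a :+ con 1) := a :* (d :* (con 1 :+ c) :+ con 1) :+ d) refl a c d)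
    ca+a+1≡0 (mobius-equation c≢-1))
    where
    b = mobius a
    c = mobius b
    d = mobius c
    b≢-1 = proj₂ (mobius-preserves p)
    c≢-1 = proj₂ (mobius-preserves (mobius-preserves p))

    ca+a+1≡0 : c * a + a + 1# ≡ 0#
    ca+a+1≡0 = cancel-vanishing c (1# + a)
      (solve 3 (λ a b c → c :* a :+ a :+ con 1 :+ c :* (b :* (con 1 :+ a) :+ con 1)
                        := (con 1 :+ a) :* (c :* (con 1 :+ b) :+ con 1) :+ con 0) refl a b c)
      (mobius-equation a≢-1) (mobius-equation b≢-1)

  count-∁NotZeroOrMinusOne : count (∁? NotZeroOrMinusOne?) ≡ 2
  count-∁NotZeroOrMinusOne = bijection⇒count≡ (∁? NotZeroOrMinusOne?) v v-injective v-sat v-onto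
    where
    0≢-1 : 0# ≢ - 1#
    0≢-1 0≡-1 = 0≢1 (sym (begin
      1#         ≡⟨ sym (+-identityʳ 1#) ⟩
      1# + 0#    ≡⟨ cong (1# +_) 0≡-1 ⟩
      1# - 1#    ≡⟨ -‿inverseʳ 1# ⟩
      0#         ∎))
      where open ≡-Reasoning

    v : Fin 2 → Carrier
    v zero       = 0#
    v (suc zero) = - 1#

    v-injective : ∀ {i j} → v i ≡ v j → i ≡ j
    v-injective {zero}     {zero}     _ = refl
    v-injective {zero}     {suc zero} e = contradiction e 0≢-1
    v-injective {suc zero} {zero}     e = contradiction (sym e) 0≢-1
    v-injective {suc zero} {suc zero} _ = refl

    v-sat : ∀ i → ¬ NotZeroOrMinusOne (v i)
    v-sat zero       (x≢0 , _)  = x≢0 refl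
    v-sat (suc zero) (_ , x≢-1) = x≢-1 refl

    v-onto : ∀ {x} → ¬ NotZeroOrMinusOne x → ∃ λ i → v i ≡ x
    v-onto {x} ¬p with x ≟ 0# | x ≟ - 1#
    ... | yes x≡0 | _        = zero , sym x≡0
    ... | no  _   | yes x≡-1 = suc zero , sym x≡-1
    ... | no x≢0  | no x≢-1  = contradiction (x≢0 , x≢-1) ¬p

  primitive-cube-root : 3 ∣ q ∸ 1 → ∃ λ ω → ω * ω * ω ≡ 1# × ω ≢ 1#
  primitive-cube-root 3∣q-1 with any? (λ y → NotZeroOrMinusOne? y ×-dec mobius y ≟ y)
  ... | yes (ω , (_ , ω≢-1) , mobius-ω≡ω) = ω , ω³≡1 , ω≢1
    where
    ω²+ω+1≡0 : ω * (1# + ω) + 1# ≡ 0#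
    ω²+ω+1≡0 = subst (λ z → z * (1# + ω) + 1# ≡ 0#) mobius-ω≡ω (mobius-equation ω≢-1)

    ω³≡1 : ω * ω * ω ≡ 1#
    ω³≡1 = cancel-vanishing 1# ω
      (solve 1 (λ ω → ω :* ω :* ω :+ con 1 :* (ω :* (con 1 :+ ω) :+ con 1)
                   := ω :* (ω :* (con 1 :+ ω) :+ con 1) :+ con 1) refl ω)
      ω²+ω+1≡0 ω²+ω+1≡0

    ω≢1 : ω ≢ 1#
    ω≢1 refl = 1+1+1≢0 3∣q-1 (trans (cong (_+ 1#) (sym (*-identityˡ _))) ω²+ω+1≡0)
  ... | no no-fixed-point = ⊥-elim (3∣n⇒3∤1+n (m∣m*n (count IsRep?)) (subst (3 ∣_) q-1≡1+3r 3∣q-1))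
    where
    open Order3Orbits enum mobius NotZeroOrMinusOne? mobius-preserves mobius³≡id
      (λ {y} p fixed → no-fixed-point (y , p , fixed))

    q-1≡1+3r : q ∸ 1 ≡ suc (3 ℕ.* count IsRep?)
    q-1≡1+3r = cong (λ m → m ∸ 1) (begin
      q                                                          ≡⟨ sym (count-complement NotZeroOrMinusOne?) ⟩
      count NotZeroOrMinusOne? ℕ.+ count (∁? NotZeroOrMinusOne?)
        ≡⟨ cong₂ ℕ._+_ orbit-count count-∁NotZeroOrMinusOne ⟩
      3 ℕ.* count IsRep? ℕ.+ 2                                   ≡⟨ ℕ.+-comm _ 2 ⟩
      suc (suc (3 ℕ.* count IsRep?))                             ∎)
      where open ≡-Reasoning

  open Enumerated enum using (orderBit; orderBit-comm⇒≡)

  ±∧same-orderBit⇒≡ : ∀ {y y′} → y′ ≡ y ⊎ y′ ≡ - y → orderBit y (- y) ≡ orderBit y′ (- y′) → y ≡ y′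
  ±∧same-orderBit⇒≡ (inj₁ y′≡y)  _         = sym y′≡y
  ±∧same-orderBit⇒≡ {y} (inj₂ refl) same-bit =
    orderBit-comm⇒≡ y (- y) (trans same-bit (cong (orderBit (- y)) (-‿involutive y)))

  module Graph (l : Carrier) (l-nonsquare : ¬ IsSquare l) (f : Carrier → Carrier) where

    l≢0 : l ≢ 0#
    l≢0 refl = l-nonsquare (0# , zeroʳ 0#)

    nonsquare-multiple : ∀ {u v} → u * u ≡ l * (v * v) → v ≡ 0#
    nonsquare-multiple {u} {v} u²≡lv² with v ≟ 0#
    ... | yes v≡0 = v≡0
    ... | no  v≢0 = contradiction (u * v ⁻¹ , (begin
      u * v ⁻¹ * (u * v ⁻¹)        ≡⟨ solve 2 (λ u w → u :* w :* (u :* w) := u :* u :* (w :* w)) refl u (v ⁻¹) ⟩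
      u * u * (v ⁻¹ * v ⁻¹)        ≡⟨ cong (_* (v ⁻¹ * v ⁻¹)) u²≡lv² ⟩
      l * (v * v) * (v ⁻¹ * v ⁻¹)  ≡⟨ solve 3 (λ l v w → l :* (v :* v) :* (w :* w) := l :* (v :* w :* (v :* w)))
                                              refl l v (v ⁻¹) ⟩
      l * (v * v ⁻¹ * (v * v ⁻¹))  ≡⟨ cong (λ z → l * (z * z)) (x*x⁻¹≡1 v≢0) ⟩
      l * (1# * 1#)                ≡⟨ cong (l *_) (*-identityʳ 1#) ⟩
      l * 1#                       ≡⟨ *-identityʳ l ⟩
      l                            ∎)) l-nonsquare
      where open ≡-Reasoning

    edge⇒ : ∀ {x y} → Edge l f x y → y * y ≡ f x ⊎ l * (y * y) ≡ f x
    edge⇒ e = Sum.map (x∙y⁻¹≈ε⇒x≈y _ _) (x∙y⁻¹≈ε⇒x≈y _ _) (zero-product e)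

    edge-to-nonZero⇒f≢0 : ∀ {x y} → y ≢ 0# → Edge l f x y → f x ≢ 0#
    edge-to-nonZero⇒f≢0 y≢0 e fx≡0 with edge⇒ e
    ... | inj₁ y²≡fx  = *-nonZero y≢0 y≢0 (trans y²≡fx fx≡0)
    ... | inj₂ ly²≡fx = *-nonZero l≢0 (*-nonZero y≢0 y≢0) (trans ly²≡fx fx≡0)

    -- The mixed case y² = f x = l y′² is excluded because l is not a square.
    edges-from-equal-values : ∀ {x x′ y y′} → y ≢ 0# → y′ ≢ 0# → Edge l f x y → Edge l f x′ y′ →
                              f x ≡ f x′ → y′ ≡ y ⊎ y′ ≡ - y
    edges-from-equal-values y≢0 y′≢0 e e′ fx≡fx′ with edge⇒ e | edge⇒ e′
    ... | inj₁ u | inj₁ u′ = square-≡⇒± (trans u (trans fx≡fx′ (sym u′)))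
    ... | inj₂ u | inj₂ u′ = square-≡⇒± (*-cancelˡ l≢0 (trans u (trans fx≡fx′ (sym u′))))
    ... | inj₁ u | inj₂ u′ = contradiction (nonsquare-multiple (trans u (trans fx≡fx′ (sym u′)))) y′≢0
    ... | inj₂ u | inj₁ u′ = contradiction (nonsquare-multiple (trans u′ (trans (sym fx≡fx′) (sym u)))) y≢0

    Edge? : ∀ x y → Dec (Edge l f x y)
    Edge? x y = _ ≟ 0#

    InDegreeZero? : Decidable (InDegreeZero l f)
    InDegreeZero? y = all? (λ x → ¬? (Edge? x y))

    in-neighbour : ∀ {y} → ¬ InDegreeZero l f y → ∃ λ x → Edge l f x y
    in-neighbour {y} ¬deg0 with any? (λ x → Edge? x y)
    ... | yes found = found
    ... | no  none  = contradiction (λ x e → none (x , e)) ¬deg0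

  module CubicGraph (l : Carrier) (l-nonsquare : ¬ IsSquare l) (a : Carrier)
                    (ω : Carrier) (ω³≡1 : ω * ω * ω ≡ 1#) (ω≢1 : ω ≢ 1#) where

    cube : Carrier → Carrier
    cube x = x * x * x

    f : Carrier → Carrier
    f x = cube x + a

    open Graph l l-nonsquare f public

    NonZero : Pred Carrier 0ℓ
    NonZero x = x ≢ 0#

    NonZero? : Decidable NonZero
    NonZero? = ∁? (_≟ 0#)

    ω*-preserves : ∀ {x} → NonZero x → NonZero (ω * x)
    ω*-preserves = *-nonZero λ ω≡0 → 0≢1 (begin
      0#          ≡⟨ sym (zeroʳ (0# * 0#)) ⟩
      cube 0#     ≡⟨ cong cube (sym ω≡0) ⟩
      cube ω      ≡⟨ ω³≡1 ⟩
      1#          ∎)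
      where open ≡-Reasoning

    cube-ω* : ∀ x → cube (ω * x) ≡ cube x
    cube-ω* x = begin
      cube (ω * x)      ≡⟨ solve 2 (λ ω x → ω :* x :* (ω :* x) :* (ω :* x) := ω :* ω :* ω :* (x :* x :* x)) refl ω x ⟩
      cube ω * cube x   ≡⟨ cong (_* cube x) ω³≡1 ⟩
      1# * cube x       ≡⟨ *-identityˡ (cube x) ⟩
      cube x            ∎
      where open ≡-Reasoning

    ω*³≡id : ∀ {x} → NonZero x → ω * (ω * (ω * x)) ≡ x
    ω*³≡id {x} _ = begin
      ω * (ω * (ω * x))  ≡⟨ solve 2 (λ ω x → ω :* (ω :* (ω :* x)) := ω :* ω :* ω :* x) refl ω x ⟩
      cube ω * x         ≡⟨ cong (_* x) ω³≡1 ⟩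
      1# * x             ≡⟨ *-identityˡ x ⟩
      x                  ∎
      where open ≡-Reasoning

    ω*-fixedPointFree : ∀ {x} → NonZero x → ω * x ≢ x
    ω*-fixedPointFree {x} x≢0 ωx≡x =
      ω≢1 (*-cancelˡ x≢0 (trans (*-comm x ω) (trans ωx≡x (sym (*-identityʳ x)))))

    open Order3Orbits enum (ω *_) NonZero? ω*-preserves ω*³≡id ω*-fixedPointFree
      using (σ^; IsRep; IsRep?; repOf; repOf-isRep; orbit-of-repOf; orbit-count)

    t : ℕ
    t = count IsRep?

    q≡1+t*3 : q ≡ suc (t ℕ.* 3)
    q≡1+t*3 = begin
      q                                         ≡⟨ sym (count-complement (_≟ 0#)) ⟩
      count (_≟ 0#) ℕ.+ count NonZero?          ≡⟨ cong₂ ℕ._+_ count-zero orbit-count ⟩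
      suc (3 ℕ.* t)                             ≡⟨ cong suc (ℕ.*-comm 3 t) ⟩
      suc (t ℕ.* 3)                             ∎
      where
      open ≡-Reasoning
      count-zero : count (_≟ 0#) ≡ 1
      count-zero = bijection⇒count≡ (_≟ 0#) (λ _ → 0#) (λ { {zero} {zero} _ → refl }) (λ _ → refl)
                     (λ x≡0 → zero , sym x≡0)

    1≤t : 1 ℕ.≤ t
    1≤t = positive t (ℕ.≤-trans one-nonZero (ℕ.≤-reflexive orbit-count))
      where
      one-nonZero : 1 ℕ.≤ count NonZero?
      one-nonZero = injective⇒≤count NonZero? (λ _ → 1#) (λ { {zero} {zero} _ → refl })
                                     (λ _ 1≡0 → 0≢1 (sym 1≡0))
      positive : ∀ m → 1 ℕ.≤ 3 ℕ.* m → 1 ℕ.≤ m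
      positive (suc m) _ = ℕ.s≤s ℕ.z≤n

    cube-σ^ : ∀ i x → cube (σ^ i x) ≡ cube x
    cube-σ^ zero             x = refl
    cube-σ^ (suc zero)       x = cube-ω* x
    cube-σ^ (suc (suc zero)) x = trans (cube-ω* (ω * x)) (cube-ω* x)

    IsClass : Pred Carrier 0ℓ
    IsClass r = r ≡ 0# ⊎ IsRep r

    IsClass? : Decidable IsClass
    IsClass? r = (r ≟ 0#) ⊎-dec IsRep? r

    class : Carrier → Carrier
    class x with x ≟ 0#
    ... | yes _ = 0#
    ... | no  _ = repOf x

    class-isClass : ∀ x → IsClass (class x)
    class-isClass x with x ≟ 0#
    ... | yes _   = inj₁ refl
    ... | no  x≢0 = inj₂ (repOf-isRep x≢0)

    cube-class : ∀ x → cube (class x) ≡ cube x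
    cube-class x with x ≟ 0#
    ... | yes x≡0 = cong cube (sym x≡0)
    ... | no  x≢0 = trans (sym (cube-σ^ (proj₁ orbit) (repOf x))) (cong cube (proj₂ orbit))
      where orbit = orbit-of-repOf x≢0

    f-class : ∀ x → f (class x) ≡ f x
    f-class x = cong (_+ a) (cube-class x)

    count-IsClass : count IsClass? ≡ suc t
    count-IsClass = bijection⇒count≡ IsClass? v v-injective v-sat v-onto
      where
      R = listing IsRep?

      v : Fin (suc t) → Carrier
      v zero    = 0#
      v (suc j) = elem R j

      v-injective : ∀ {i j} → v i ≡ v j → i ≡ j
      v-injective {zero}  {zero}  _ = refl
      v-injective {zero}  {suc j} e = contradiction (sym e) (proj₁ (elem-sat R j))
      v-injective {suc i} {zero}  e = contradiction e (proj₁ (elem-sat R i))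
      v-injective {suc i} {suc j} e = cong suc (elem-injective R e)

      v-sat : ∀ i → IsClass (v i)
      v-sat zero    = inj₁ refl
      v-sat (suc j) = inj₂ (elem-sat R j)

      v-onto : ∀ {x} → IsClass x → ∃ λ i → v i ≡ x
      v-onto (inj₁ x≡0) = zero , sym x≡0
      v-onto (inj₂ rep) = suc (index R rep) , elem-index R rep

    NonRootClass : Pred Carrier 0ℓ
    NonRootClass r = IsClass r × f r ≢ 0#

    NonRootClass? : Decidable NonRootClass
    NonRootClass? r = IsClass? r ×-dec ¬? (f r ≟ 0#)

    count-NonRootClass : count NonRootClass? ℕ.≤ 1 ℕ.+ t
    count-NonRootClass = ℕ.≤-trans (⊆⇒count≤ NonRootClass? IsClass? proj₁) (ℕ.≤-reflexive count-IsClass)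

    -- The class of a cube root of −a is a root of f.
    count-NonRootClass-cube : IsCube (- a) → count NonRootClass? ℕ.≤ 0 ℕ.+ t
    count-NonRootClass-cube (z , z³≡-a) = ℕ.s≤s⁻¹ (ℕ.≤-trans
      (⊆⇒count< NonRootClass? IsClass? proj₁ (class-isClass z) (λ (_ , f≢0) → f≢0 f[class-z]≡0))
      (ℕ.≤-reflexive count-IsClass))
      where
      f[class-z]≡0 : f (class z) ≡ 0#
      f[class-z]≡0 = trans (f-class z) (trans (cong (_+ a) z³≡-a) (-‿inverseˡ a))

    -- A vertex y ≠ 0 with an in-edge is determined by the class of an in-neighbour and by
    -- which of y, −y comes first in the enumeration.
    count-HasInEdge : count (∁? InDegreeZero?) ℕ.≤ suc (count NonRootClass? ℕ.* 2)
    count-HasInEdge = injective⇒count≤ (∁? InDegreeZero?) (λ y h → code h (y ≟ 0#))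
                        (λ h h′ → code-injective h h′ _ _)
      where
      N = listing NonRootClass?

      source-class : ∀ {y} (h : ¬ InDegreeZero l f y) → y ≢ 0# → NonRootClass (class (proj₁ (in-neighbour h)))
      source-class h y≢0 = class-isClass _ ,
        λ f≡0 → edge-to-nonZero⇒f≢0 y≢0 (proj₂ (in-neighbour h)) (trans (sym (f-class _)) f≡0)

      code : ∀ {y} → ¬ InDegreeZero l f y → Dec (y ≡ 0#) → Fin (suc (count NonRootClass? ℕ.* 2))
      code     h (yes _)   = zero
      code {y} h (no  y≢0) = suc (combine (index N (source-class h y≢0)) (orderBit y (- y)))

      code-injective : ∀ {y y′} h h′ d d′ → code {y} h d ≡ code {y′} h′ d′ → y ≡ y′
      code-injective h h′ (yes y≡0) (yes y′≡0) _ = trans y≡0 (sym y′≡0)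
      code-injective {y} {y′} h h′ (no y≢0) (no y′≢0) e =
        ±∧same-orderBit⇒≡
          (edges-from-equal-values y≢0 y′≢0 (proj₂ (in-neighbour h)) (proj₂ (in-neighbour h′)) same-value)
          (proj₂ same-class-and-bit)
        where
        same-class-and-bit = Fin.combine-injective (index N (source-class h y≢0)) (orderBit y (- y))
                                                    (index N (source-class h′ y′≢0)) (orderBit y′ (- y′))
                                                    (Fin.suc-injective e)
        same-value : f (proj₁ (in-neighbour h)) ≡ f (proj₁ (in-neighbour h′))
        same-value = trans (sym (f-class _))
                       (trans (cong f (index-injective N _ _ (proj₁ same-class-and-bit))) (f-class _))

    zero-InDegreeZero : ¬ IsCube (- a) → InDegreeZero l f 0#
    zero-InDegreeZero ¬cube x e = ¬cube (x , +-inverseʳ-unique a (cube x) (trans (+-comm a _) fx≡0))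
      where
      fx≡0 : f x ≡ 0#
      fx≡0 with edge⇒ e
      ... | inj₁ 0²≡fx  = trans (sym 0²≡fx) (zeroʳ 0#)
      ... | inj₂ l0²≡fx = trans (sym l0²≡fx) (trans (cong (l *_) (zeroʳ 0#)) (zeroʳ l))

    t∸2e≤count-InDegreeZero : ∀ e → count NonRootClass? ℕ.≤ e ℕ.+ t → t ∸ e ℕ.* 2 ℕ.≤ count InDegreeZero?
    t∸2e≤count-InDegreeZero e bound =
      ∸-lower-bound e (trans (count-complement InDegreeZero?) q≡1+t*3) count-HasInEdge bound

    t≤count-InDegreeZero : IsCube (- a) → t ℕ.≤ count InDegreeZero?
    t≤count-InDegreeZero −a-cube = t∸2e≤count-InDegreeZero 0 (count-NonRootClass-cube −a-cube)

    t∸2≤count-InDegreeZero : t ∸ 2 ℕ.≤ count InDegreeZero?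
    t∸2≤count-InDegreeZero = t∸2e≤count-InDegreeZero 1 count-NonRootClass

    [q∸1]/3≡t : (q ∸ 1) / 3 ≡ t
    [q∸1]/3≡t = trans (cong (λ m → (m ∸ 1) / 3) q≡1+t*3) (m*n/n≡m t 3)

    [q∸7]/3≡t∸2 : (q ∸ 7) / 3 ≡ t ∸ 2
    [q∸7]/3≡t∸2 = trans (cong (λ m → (m ∸ 7) / 3) q≡1+t*3)
                    (trans (cong (_/ 3) (sym (ℕ.*-distribʳ-∸ 3 t 2))) (m*n/n≡m (t ∸ 2) 3))

proposition6p2 : (q : ℕ) → (F : FiniteField q) →
  (∃₂ λ p k → Prime p × p % 2 ≡ 1 × q ≡ p ^ suc k) →
  3 ∣ (q ∸ 1) →
  (l : FiniteField.Carrier F) → ¬ FiniteField.IsSquare F l →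
  (a : FiniteField.Carrier F) →
  let open FiniteField F
      f : Carrier → Carrier
      f x = x * x * x + a
  in ((IsCube (- a) → AtLeast ((q ∸ 1) / 3) (InDegreeZero l f))
      × (¬ IsCube (- a) → AtLeast ((q ∸ 7) / 3) (InDegreeZero l f)))
     × AtLeast 1 (InDegreeZero l f)
proposition6p2 q F _ 3∣q-1 l l-nonsquare a
  with ω , ω³≡1 , ω≢1 ← FieldProperties.primitive-cube-root F 3∣q-1
  = (cube-case , noncube-case) , one
  where
  open FiniteField F
  open FieldProperties F
  open CubicGraph l l-nonsquare a ω ω³≡1 ω≢1
  open Enumerated enum using (count; ≤count⇒distinct)

  atLeast : ∀ {M N} → M ≡ N → N ℕ.≤ count InDegreeZero? → AtLeast M (InDegreeZero l f)
  atLeast refl = ≤count⇒distinct InDegreeZero?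

  cube-case : IsCube (- a) → AtLeast ((q ∸ 1) / 3) (InDegreeZero l f)
  cube-case −a-cube = atLeast [q∸1]/3≡t (t≤count-InDegreeZero −a-cube)

  noncube-case : ¬ IsCube (- a) → AtLeast ((q ∸ 7) / 3) (InDegreeZero l f)
  noncube-case _ = atLeast [q∸7]/3≡t∸2 t∸2≤count-InDegreeZero

  one : AtLeast 1 (InDegreeZero l f)
  one with any? (λ z → z * z * z ≟ - a)
  ... | yes −a-cube = atLeast refl (ℕ.≤-trans 1≤t (t≤count-InDegreeZero −a-cube))
  ... | no  ¬cube   = (λ _ → 0#) , (λ { zero zero _ → refl }) , (λ _ → zero-InDegreeZero ¬cube)
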